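{- Let $k\ge5$, let $\mathcal{C}$ be a $k$-dense family of cycles, and let $G'$ be a $\mathcal{C}$-free graph with a specified vertex $h$. If $B$ is a block of $G'$ that is either rooted or nearly $h$-dominated, then every path in $B$ not containing the vertex $r_B$ has length at most $k-3$.
   Context: $C_\ell$ is the cycle of length $\ell$; a graph is $\mathcal{C}$-free if it contains no subgraph isomorphic to a member of $\mathcal{C}$. For $k\geq5$, a family of cycles $\mathcal{C}$ is $k$-dense if: (1) $C_k,C_{k+1}\in\mathcal{C}$, except that when $k=5$ only $C_5\in\mathcal{C}$ is required; (2) $C_\ell\notin\mathcal{C}$ for all $\ell<k$; (3) for every $s\ge3$ there is $\ell$ with $s+2\le\ell\le3+(k-2)(s-2)$ and $C_\ell\in\mathcal{C}$. A block of a graph is a maximal subgraph that is either a $K_2$ or $2$-connected. Distances are taken in $G'$. A block $B$ is rooted if some vertex $r_B\in B$ is adjacent to all other vertices of $B$ and $d(r_B,h)<d(u,h)$ for all $u\in B\setminus\{r_B\}$; $r_B$ is the root. A block $B$ is nearly $h$-dominated if $h\in B$ and all but one vertex of $B$ are adjacent to $h$; for such $B$ we set $r_B:=h$. -}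

module Defs where

open import Data.Nat using (ℕ; zero; suc; _+_; _*_; _∸_; _≤_; _<_)
open import Data.Fin using (Fin; inject₁; fromℕ) renaming (zero to fzero; suc to fsuc)
open import Data.Product using (Σ; _×_; ∃; ∃-syntax)
open import Data.Sum using (_⊎_)
open import Relation.Nullary using (¬_)
open import Relation.Binary.PropositionalEquality using (_≡_; _≢_)
open import Function.Definitions using (Injective)

record Graph : Set₁ where
  field
    n      : ℕ
    Adj    : Fin n → Fin n → Set
    Adj-sym    : ∀ {u v} → Adj u v → Adj v u
    Adj-irrefl : ∀ {u} → ¬ Adj u u
open Graph public

-- A family of cycles, given by the set of lengths ℓ with C_ℓ ∈ 𝒞.
CycleFamily : Set₁
CycleFamily = ℕ → Set

module _ (G : Graph) where

  HasCycle : ℕ → Set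
  HasCycle ℓ = Σ ℕ λ m → (suc m ≡ ℓ) × (3 ≤ ℓ) ×
    Σ (Fin (suc m) → Fin (n G)) λ c →
      Injective _≡_ _≡_ c ×
      (∀ (i : Fin m) → Adj G (c (inject₁ i)) (c (fsuc i))) ×
      Adj G (c (fromℕ m)) (c fzero)

  Free : CycleFamily → Set
  Free 𝒞 = ∀ ℓ → 𝒞 ℓ → ¬ HasCycle ℓ

  Walk : Fin (n G) → Fin (n G) → ℕ → Set
  Walk u v m = Σ (Fin (suc m) → Fin (n G)) λ p →
    (p fzero ≡ u) × (p (fromℕ m) ≡ v) ×
    (∀ (i : Fin m) → Adj G (p (inject₁ i)) (p (fsuc i)))

  -- d(x,h) < d(y,h) in G' (with d = ∞ for unreachable vertices):
  -- x reaches h by a walk of some length m, and y has no walk to h of length ≤ m.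
  DistLess : Fin (n G) → Fin (n G) → Fin (n G) → Set
  DistLess h x y = Σ ℕ λ m → Walk x h m × (∀ m' → m' ≤ m → ¬ Walk y h m')

  record Subgraph : Set₁ where
    field
      V : Fin (n G) → Set
      E : Fin (n G) → Fin (n G) → Set
      E-adj : ∀ {u v} → E u v → Adj G u v
      E-sym : ∀ {u v} → E u v → E v u
      E-V   : ∀ {u v} → E u v → V u × V v
  open Subgraph public

  _⊆_ : Subgraph → Subgraph → Set
  H ⊆ H' = (∀ v → V H v → V H' v) × (∀ u v → E H u v → E H' u v)

  WalkIn : Subgraph → Fin (n G) → Fin (n G) → Set
  WalkIn H u v = Σ ℕ λ m → Σ (Fin (suc m) → Fin (n G)) λ p →
    (p fzero ≡ u) × (p (fromℕ m) ≡ v) ×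
    (∀ (i : Fin m) → E H (p (inject₁ i)) (p (fsuc i)))

  WalkInAvoiding : Subgraph → Fin (n G) → Fin (n G) → Fin (n G) → Set
  WalkInAvoiding H x u v = Σ ℕ λ m → Σ (Fin (suc m) → Fin (n G)) λ p →
    (p fzero ≡ u) × (p (fromℕ m) ≡ v) ×
    (∀ (i : Fin m) → E H (p (inject₁ i)) (p (fsuc i))) ×
    (∀ (i : Fin (suc m)) → p i ≢ x)

  IsK2 : Subgraph → Set
  IsK2 H = Σ (Fin (n G)) λ u → Σ (Fin (n G)) λ v →
    (u ≢ v) × V H u × V H v × (∀ w → V H w → (w ≡ u) ⊎ (w ≡ v)) × E H u v

  Is2Connected : Subgraph → Set
  Is2Connected H =
    (Σ (Fin (n G)) λ a → Σ (Fin (n G)) λ b → Σ (Fin (n G)) λ c →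
       V H a × V H b × V H c × (a ≢ b) × (a ≢ c) × (b ≢ c)) ×
    (∀ u v → V H u → V H v → WalkIn H u v) ×
    (∀ x u v → V H u → V H v → u ≢ x → v ≢ x → WalkInAvoiding H x u v)

  IsBlock : Subgraph → Set₁
  IsBlock B = (IsK2 B ⊎ Is2Connected B) ×
    (∀ (H : Subgraph) → B ⊆ H → (IsK2 H ⊎ Is2Connected H) → H ⊆ B)

  RootedAt : Fin (n G) → Subgraph → Fin (n G) → Set
  RootedAt h B r = V B r ×
    (∀ u → V B u → u ≢ r → Adj G r u) ×
    (∀ u → V B u → u ≢ r → DistLess h r u)

  NearlyDominated : Fin (n G) → Subgraph → Set
  NearlyDominated h B = V B h ×
    Σ (Fin (n G)) λ w → ∀ u → V B u → u ≢ h → u ≢ w → Adj G h u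

  PathInAvoiding : Subgraph → Fin (n G) → ℕ → Set
  PathInAvoiding B r m = Σ (Fin (suc m) → Fin (n G)) λ p →
    Injective _≡_ _≡_ p × (∀ i → V B (p i)) ×
    (∀ (i : Fin m) → E B (p (inject₁ i)) (p (fsuc i))) ×
    (∀ i → p i ≢ r)

KDense : ℕ → CycleFamily → Set
KDense k 𝒞 =
  (𝒞 k × (k ≡ 5 ⊎ 𝒞 (suc k))) ×
  (∀ ℓ → ℓ < k → ¬ 𝒞 ℓ) ×
  (∀ s → 3 ≤ s → Σ ℕ λ ℓ → (s + 2 ≤ ℓ) × (ℓ ≤ 3 + (k ∸ 2) * (s ∸ 2)) × 𝒞 ℓ)

-- A path in B − r_B longer than k − 3 contains one of length exactly k − 2, and if both
-- its ends are adjacent to r_B it closes through r_B into a C_k. In a rooted block r_B is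
-- adjacent to every other vertex. In a nearly h-dominated block only one vertex w misses h,
-- and B is 2-connected as it contains a path on three vertices. If w is an end of the path,
-- a walk from w to h avoiding the successor of w starts with a neighbour x of w; either
-- x = h, or x lies off the path and is prepended to it (dropping the far end), or x lies on
-- the path and a Pósa rotation at w moves w into the interior.
module Submission where

open import Defs
open import Level using (_⊔_)
open import Data.Nat using (ℕ; zero; suc; _+_; _∸_; _≤_; _<_; z≤n; s≤s; z<s; _≤?_)
open import Data.Nat.Properties
  using ( ≤-refl; ≤-trans; ≤-antisym; <⇒≤; <⇒≢; <⇒≱; ≮⇒≥; ≰⇒>; <-≤-trans; n≤1+n; m≤n⇒m≤1+n
        ; m∸n≤m; n∸n≡0; ∸-cancelˡ-≡; ∸-monoʳ-<; anyUpTo?)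
open import Data.Nat.DivMod using (_mod_; m≤n⇒m%n≡m)
open import Data.Fin using (Fin; toℕ; inject₁; fromℕ; fromℕ<; _≟_)
  renaming (zero to fzero; suc to fsuc)
open import Data.Fin.Properties
  using (toℕ-injective; toℕ<n; toℕ≤pred[n]; toℕ-fromℕ; toℕ-fromℕ<; toℕ-inject₁)
open import Data.Product using (_×_; _,_; ∃; proj₁; proj₂)
open import Data.Sum using (_⊎_; inj₁; inj₂; [_,_])
open import Data.Empty using (⊥-elim)
open import Function using (_∘_; id)
open import Function.Definitions using (Injective)
open import Relation.Nullary using (¬_; yes; no)
open import Relation.Binary.Core using (Rel)
open import Relation.Binary.Definitions using (Symmetric; DecidableEquality)
open import Relation.Binary.PropositionalEquality
  using (_≡_; _≢_; refl; sym; trans; cong; subst; subst₂)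

private variable
  i j K L : ℕ

m∸n≡1+[m∸1+n] : i < j → j ∸ i ≡ suc (j ∸ suc i)
m∸n≡1+[m∸1+n] {zero}  {suc j} _         = refl
m∸n≡1+[m∸1+n] {suc i} {suc j} (s≤s i<j) = m∸n≡1+[m∸1+n] i<j

-- Vertices are indexed by all of ℕ (those past K are junk) so that re-indexing is arithmetic.
record Path {a ℓ} {A : Set a} (R : Rel A ℓ) (K : ℕ) : Set (a ⊔ ℓ) where
  field
    vertex    : ℕ → A
    injective : i ≤ K → j ≤ K → vertex i ≡ vertex j → i ≡ j
    step      : i < K → R (vertex i) (vertex (suc i))
open Path public

module _ {a ℓ} {A : Set a} {R : Rel A ℓ} where

  map : ∀ {ℓ′} {S : Rel A ℓ′} → (∀ {u v} → R u v → S u v) → Path R K → Path S K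
  map R⇒S p = record { vertex = vertex p ; injective = injective p ; step = R⇒S ∘ step p }

  take : K ≤ L → Path R L → Path R K
  take K≤L p = record
    { vertex    = vertex p
    ; injective = λ i≤K j≤K → injective p (≤-trans i≤K K≤L) (≤-trans j≤K K≤L)
    ; step      = λ i<K → step p (<-≤-trans i<K K≤L)
    }

  reverse : Symmetric R → Path R K → Path R K
  reverse {K} R-sym p = record
    { vertex    = λ i → vertex p (K ∸ i)
    ; injective = λ {i} {j} i≤K j≤K eq →
        ∸-cancelˡ-≡ i≤K j≤K (injective p (m∸n≤m K i) (m∸n≤m K j) eq)
    ; step      = step′
    }
    where
    step′ : i < K → R (vertex p (K ∸ i)) (vertex p (K ∸ suc i))
    step′ {i} i<K = subst (λ t → R (vertex p t) (vertex p (K ∸ suc i))) (sym K∸i≡)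
      (R-sym (step p (subst (_≤ K) K∸i≡ (m∸n≤m K i))))
      where
      K∸i≡ : K ∸ i ≡ suc (K ∸ suc i)
      K∸i≡ = m∸n≡1+[m∸1+n] i<K

  cons : (x : A) (p : Path R K) → R x (vertex p 0) → (∀ {i} → i ≤ K → vertex p i ≢ x) →
         Path R (suc K)
  cons {K} x p x-step x∉p = record { vertex = vertex′ ; injective = injective′ ; step = step′ }
    where
    vertex′ : ℕ → A
    vertex′ zero    = x
    vertex′ (suc i) = vertex p i

    injective′ : i ≤ suc K → j ≤ suc K → vertex′ i ≡ vertex′ j → i ≡ j
    injective′ {zero}  {zero}  _         _         _  = refl
    injective′ {zero}  {suc j} _         (s≤s j≤K) eq = ⊥-elim (x∉p j≤K (sym eq))
    injective′ {suc i} {zero}  (s≤s i≤K) _         eq = ⊥-elim (x∉p i≤K eq)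
    injective′ {suc i} {suc j} (s≤s i≤K) (s≤s j≤K) eq = cong suc (injective p i≤K j≤K eq)

    step′ : i < suc K → R (vertex′ i) (vertex′ (suc i))
    step′ {zero}  _         = x-step
    step′ {suc i} (s≤s i<K) = step p i<K

  locate : DecidableEquality A → (x : A) (p : Path R K) →
           (∃ λ j → j ≤ K × x ≡ vertex p j) ⊎ (∀ {j} → j ≤ K → vertex p j ≢ x)
  locate {K} _≟ₐ_ x p with anyUpTo? (λ j → x ≟ₐ vertex p j) (suc K)
  ... | yes (j , s≤s j≤K , x≡pⱼ) = inj₁ (j , j≤K , x≡pⱼ)
  ... | no ∄j                    = inj₂ λ j≤K pⱼ≡x → ∄j (_ , s≤s j≤K , sym pⱼ≡x)

-- Pósa rotation: an edge from vertex 0 to vertex (1 + j) turns the path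
-- 0, 1, …, K into j, j − 1, …, 0, 1 + j, …, K.

rotation : ℕ → ℕ → ℕ
rotation j i with i ≤? j
... | yes _ = j ∸ i
... | no  _ = i

rotation-0 : ∀ j → rotation j 0 ≡ j
rotation-0 j with 0 ≤? j
... | yes _  = refl
... | no 0≰j = ⊥-elim (0≰j z≤n)

rotation-fixes : j < i → rotation j i ≡ i
rotation-fixes {j} {i} j<i with i ≤? j
... | yes i≤j = ⊥-elim (<⇒≱ j<i i≤j)
... | no  _   = refl

rotation-≤ : j ≤ K → i ≤ K → rotation j i ≤ K
rotation-≤ {j} {i = i} j≤K i≤K with i ≤? j
... | yes _ = ≤-trans (m∸n≤m j i) j≤K
... | no  _ = i≤K

rotation-injective : ∀ {j a b} → rotation j a ≡ rotation j b → a ≡ b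
rotation-injective {j} {a} {b} eq with a ≤? j | b ≤? j
... | yes a≤j | yes b≤j = ∸-cancelˡ-≡ a≤j b≤j eq
... | yes a≤j | no  b≰j = ⊥-elim (b≰j (subst (_≤ j) eq (m∸n≤m j a)))
... | no  a≰j | yes b≤j = ⊥-elim (a≰j (subst (_≤ j) (sym eq) (m∸n≤m j b)))
... | no  _   | no  _   = eq

module _ {a ℓ} {A : Set a} {R : Rel A ℓ} (R-sym : Symmetric R) where

  rotate : (p : Path R K) (j : ℕ) → suc j ≤ K → R (vertex p 0) (vertex p (suc j)) → Path R K
  rotate {K} p j j<K chord = record
    { vertex    = vertex p ∘ rotation j
    ; injective = λ i≤K i′≤K eq →
        rotation-injective (injective p (rotation-≤ j≤K i≤K) (rotation-≤ j≤K i′≤K) eq)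
    ; step      = step′
    }
    where
    j≤K : j ≤ K
    j≤K = <⇒≤ j<K

    step′ : i < K → R (vertex p (rotation j i)) (vertex p (rotation j (suc i)))
    step′ {i} i<K with i ≤? j | suc i ≤? j
    ... | yes _   | yes i<j = subst (λ t → R (vertex p t) (vertex p (j ∸ suc i)))
                                (sym (m∸n≡1+[m∸1+n] i<j))
                                (R-sym (step p (<-≤-trans (∸-monoʳ-< z<s i<j) j≤K)))
    ... | no  i≰j | yes i<j = ⊥-elim (i≰j (<⇒≤ i<j))
    ... | no  _   | no  _   = step p i<K
    ... | yes i≤j | no  i≮j with ≤-antisym i≤j (≮⇒≥ i≮j)
    ...   | refl = subst (λ t → R (vertex p t) (vertex p (suc i))) (sym (n∸n≡0 i)) chord

  rotate-start : (p : Path R K) (j : ℕ) (j<K : suc j ≤ K) (chord : R (vertex p 0) (vertex p (suc j))) →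
                 vertex (rotate p j j<K chord) 0 ≡ vertex p j
  rotate-start p j _ _ = cong (vertex p) (rotation-0 j)

  rotate-end : (p : Path R K) (j : ℕ) (j<K : suc j ≤ K) (chord : R (vertex p 0) (vertex p (suc j))) →
               vertex (rotate p j j<K chord) K ≡ vertex p K
  rotate-end p j j<K _ = cong (vertex p) (rotation-fixes j<K)

two-of-three : ∀ {a} {A : Set a} {u v x y z : A} →
               x ≡ u ⊎ x ≡ v → y ≡ u ⊎ y ≡ v → z ≡ u ⊎ z ≡ v → x ≡ y ⊎ x ≡ z ⊎ y ≡ z
two-of-three (inj₁ refl) (inj₁ refl) _           = inj₁ refl
two-of-three (inj₂ refl) (inj₂ refl) _           = inj₁ refl
two-of-three (inj₁ refl) (inj₂ refl) (inj₁ refl) = inj₂ (inj₁ refl)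
two-of-three (inj₁ refl) (inj₂ refl) (inj₂ refl) = inj₂ (inj₂ refl)
two-of-three (inj₂ refl) (inj₁ refl) (inj₁ refl) = inj₂ (inj₂ refl)
two-of-three (inj₂ refl) (inj₁ refl) (inj₂ refl) = inj₂ (inj₁ refl)

toℕ-mod : i ≤ K → toℕ (i mod suc K) ≡ i
toℕ-mod i≤K = trans (toℕ-fromℕ< _) (m≤n⇒m%n≡m i≤K)

module GraphPaths (G : Graph) where

  private
    Vertex : Set
    Vertex = Fin (n G)

  _∖_ : Subgraph G → Vertex → Subgraph G
  H ∖ x = record
    { V     = λ v → V H v × v ≢ x
    ; E     = λ u v → E H u v × u ≢ x × v ≢ x
    ; E-adj = λ (uv , _) → E-adj H uv
    ; E-sym = λ (uv , u≢x , v≢x) → E-sym H uv , v≢x , u≢x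
    ; E-V   = λ (uv , u≢x , v≢x) → (proj₁ (E-V H uv) , u≢x) , (proj₂ (E-V H uv) , v≢x)
    }

  path-vertex∈ : (H : Subgraph G) (p : Path (E H) (suc K)) → i ≤ suc K → V H (vertex p i)
  path-vertex∈ {i = zero}  H p _         = proj₁ (E-V H (step p z<s))
  path-vertex∈ {i = suc i} H p (s≤s i≤K) = proj₂ (E-V H (step p (s≤s i≤K)))

  closed-path⇒cycle : (p : Path (Adj G) (2 + K)) → Adj G (vertex p (2 + K)) (vertex p 0) →
                      HasCycle G (3 + K)
  closed-path⇒cycle {K} p closing =
    2 + K , refl , s≤s (s≤s (s≤s z≤n)) , c , c-injective , c-step , c-closing
    where
    c : Fin (3 + K) → Vertex
    c = vertex p ∘ toℕ

    c-injective : Injective _≡_ _≡_ c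
    c-injective eq = toℕ-injective (injective p (toℕ≤pred[n] _) (toℕ≤pred[n] _) eq)

    c-step : (i : Fin (2 + K)) → Adj G (c (inject₁ i)) (c (fsuc i))
    c-step i rewrite toℕ-inject₁ i = step p (toℕ<n i)

    c-closing : Adj G (c (fromℕ (2 + K))) (c fzero)
    c-closing rewrite toℕ-fromℕ (2 + K) = closing

  cone⇒cycle : (z : Vertex) (p : Path (Adj G) (suc K)) → (∀ {i} → i ≤ suc K → vertex p i ≢ z) →
               Adj G z (vertex p 0) → Adj G z (vertex p (suc K)) → HasCycle G (3 + K)
  cone⇒cycle z p z∉p z-start z-end = closed-path⇒cycle (cons z p z-start z∉p) (Adj-sym G z-end)

  apex⇒cycle : (H : Subgraph G) (z : Vertex) (p : Path (E (H ∖ z)) (suc K)) →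
               Adj G z (vertex p 0) → Adj G z (vertex p (suc K)) → HasCycle G (3 + K)
  apex⇒cycle H z p = cone⇒cycle z (map (E-adj (H ∖ z)) p) (proj₂ ∘ path-vertex∈ (H ∖ z) p)

  fromPathInAvoiding : {B : Subgraph G} {r : Vertex} {m : ℕ} →
                       PathInAvoiding G B r m → Path (E (B ∖ r)) m
  fromPathInAvoiding {B} {r} {m} (p , p-injective , _ , p-step , p≢r) = record
    { vertex    = λ i → p (i mod suc m)
    ; injective = λ i≤m j≤m eq →
        trans (sym (toℕ-mod i≤m)) (trans (cong toℕ (p-injective eq)) (toℕ-mod j≤m))
    ; step      = λ i<m → step′ i<m , p≢r _ , p≢r _
    }
    where
    step′ : i < m → E B (p (i mod suc m)) (p (suc i mod suc m))
    step′ {i} i<m = subst₂ (λ a b → E B (p a) (p b)) inject₁t≡ fsuc-t≡ (p-step t)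
      where
      t = fromℕ< i<m
      inject₁t≡ : inject₁ t ≡ i mod suc m
      inject₁t≡ = toℕ-injective
        (trans (toℕ-inject₁ t) (trans (toℕ-fromℕ< i<m) (sym (toℕ-mod (<⇒≤ i<m)))))
      fsuc-t≡ : fsuc t ≡ suc i mod suc m
      fsuc-t≡ = toℕ-injective (trans (cong suc (toℕ-fromℕ< i<m)) (sym (toℕ-mod i<m)))

  walk-first-step : {H : Subgraph G} {x u v : Vertex} →
                    WalkInAvoiding G H x u v → u ≢ v → ∃ λ y → E H u y × y ≢ x
  walk-first-step (zero  , p , refl , p-end , _      , _  ) u≢v = ⊥-elim (u≢v p-end)
  walk-first-step (suc _ , p , refl , _     , p-step , p≢x) _   =
    p (fsuc fzero) , p-step fzero , p≢x (fsuc fzero)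

  IsBlock⇒Is2Connected : {H : Subgraph G} → IsBlock G H → Path (E H) (2 + K) → Is2Connected G H
  IsBlock⇒Is2Connected {H = H} (K₂⊎2-connected , _) p = [ ⊥-elim ∘ ¬K₂ , id ] K₂⊎2-connected
    where
    distinct : i ≤ 2 + _ → j ≤ 2 + _ → i ≢ j → vertex p i ≢ vertex p j
    distinct i≤ j≤ i≢j eq = i≢j (injective p i≤ j≤ eq)

    ¬K₂ : ¬ IsK2 G H
    ¬K₂ (u , v , _ , _ , _ , u-or-v , _)
      with two-of-three (u-or-v _ (path-vertex∈ H p z≤n))
                        (u-or-v _ (path-vertex∈ H p (s≤s z≤n)))
                        (u-or-v _ (path-vertex∈ H p (s≤s (s≤s z≤n))))
    ... | inj₁ eq        = distinct z≤n (s≤s z≤n) (λ ()) eq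
    ... | inj₂ (inj₁ eq) = distinct z≤n (s≤s (s≤s z≤n)) (λ ()) eq
    ... | inj₂ (inj₂ eq) = distinct (s≤s z≤n) (s≤s (s≤s z≤n)) (λ ()) eq

  rooted⇒cycle : {h r : Vertex} {B : Subgraph G} → RootedAt G h B r →
                 (p : Path (E (B ∖ r)) (suc K)) → HasCycle G (3 + K)
  rooted⇒cycle {K} {r = r} {B} (_ , r-adj , _) p = apex⇒cycle B r p (adj-r z≤n) (adj-r ≤-refl)
    where
    adj-r : i ≤ suc K → Adj G r (vertex p i)
    adj-r i≤ = r-adj _ (proj₁ (path-vertex∈ (B ∖ r) p i≤)) (proj₂ (path-vertex∈ (B ∖ r) p i≤))

  module NearlyDominatedBlock
    (B : Subgraph G) (h w : Vertex) (h∈B : V B h)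
    (dominated : ∀ u → V B u → u ≢ h → u ≢ w → Adj G h u)
    (connected-avoiding : ∀ x u v → V B u → V B v → u ≢ x → v ≢ x → WalkInAvoiding G B x u v)
    {K : ℕ} (1≤K : 1 ≤ K)
    where

    private
      Path∖h : Set
      Path∖h = Path (E (B ∖ h)) (suc K)

    on-path : (q : Path∖h) → i ≤ suc K → V (B ∖ h) (vertex q i)
    on-path = path-vertex∈ (B ∖ h)

    adj-h : (q : Path∖h) → i ≤ suc K → vertex q i ≢ w → Adj G h (vertex q i)
    adj-h q i≤ = dominated _ (proj₁ (on-path q i≤)) (proj₂ (on-path q i≤))

    ends-off-w⇒cycle : (q : Path∖h) → vertex q 0 ≢ w → vertex q (suc K) ≢ w → HasCycle G (3 + K)
    ends-off-w⇒cycle q start≢w end≢w =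
      apex⇒cycle B h q (adj-h q z≤n start≢w) (adj-h q ≤-refl end≢w)

    off-w : (q : Path∖h) → vertex q 0 ≡ w → i ≤ suc K → i ≢ 0 → vertex q i ≢ w
    off-w q q₀≡w i≤ i≢0 qᵢ≡w = i≢0 (injective q i≤ z≤n (trans qᵢ≡w (sym q₀≡w)))

    w-neighbour⇒cycle : (q : Path∖h) → vertex q 0 ≡ w →
                        (x : Vertex) → E B (vertex q 0) x → x ≢ vertex q 1 → HasCycle G (3 + K)
    w-neighbour⇒cycle q q₀≡w x q₀x x≢q₁ with x ≟ h
    ... | yes refl =
      apex⇒cycle B h q (Adj-sym G (E-adj B q₀x)) (adj-h q ≤-refl (off-w q q₀≡w ≤-refl λ ()))
    ... | no x≢h with locate _≟_ x q
    ...   | inj₂ x∉q = ends-off-w⇒cycle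
              (cons x (take (n≤1+n K) q) (E-sym B q₀x , x≢h , q₀≢h) (x∉q ∘ m≤n⇒m≤1+n))
              (λ x≡w → x∉q z≤n (trans q₀≡w (sym x≡w)))
              (off-w q q₀≡w (n≤1+n K) λ K≡0 → <⇒≢ 1≤K (sym K≡0))
      where
      q₀≢h : vertex q 0 ≢ h
      q₀≢h = proj₂ (on-path q z≤n)
    ...   | inj₁ (zero , _ , refl) = ⊥-elim (Adj-irrefl G (E-adj B q₀x))
    ...   | inj₁ (suc zero , _ , refl) = ⊥-elim (x≢q₁ refl)
    ...   | inj₁ (suc (suc j) , j+2≤ , refl) = ends-off-w⇒cycle rotated
              (subst (_≢ w) (sym (rotate-start R-sym q (suc j) j+2≤ chord))
                 (off-w q q₀≡w (<⇒≤ j+2≤) λ ()))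
              (subst (_≢ w) (sym (rotate-end R-sym q (suc j) j+2≤ chord))
                 (off-w q q₀≡w ≤-refl λ ()))
      where
      R-sym : Symmetric (E (B ∖ h))
      R-sym = E-sym (B ∖ h)
      chord : E (B ∖ h) (vertex q 0) (vertex q (2 + j))
      chord = q₀x , proj₂ (on-path q z≤n) , x≢h
      rotated : Path∖h
      rotated = rotate R-sym q (suc j) j+2≤ chord

    w-start⇒cycle : (q : Path∖h) → vertex q 0 ≡ w → HasCycle G (3 + K)
    w-start⇒cycle q q₀≡w = let x , q₀x , x≢q₁ = walk-first-step {H = B} walk q₀≢h in
                           w-neighbour⇒cycle q q₀≡w x q₀x x≢q₁
      where
      q₀≢h : vertex q 0 ≢ h
      q₀≢h = proj₂ (on-path q z≤n)
      h≢q₁ : h ≢ vertex q 1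
      h≢q₁ h≡q₁ = proj₂ (on-path q (s≤s z≤n)) (sym h≡q₁)
      q₀≢q₁ : vertex q 0 ≢ vertex q 1
      q₀≢q₁ eq with injective q z≤n (s≤s z≤n) eq
      ... | ()
      walk : WalkInAvoiding G B (vertex q 1) (vertex q 0) h
      walk = connected-avoiding _ _ _ (proj₁ (on-path q z≤n)) h∈B q₀≢q₁ h≢q₁

    path⇒cycle : (q : Path∖h) → HasCycle G (3 + K)
    path⇒cycle q with vertex q 0 ≟ w | vertex q (suc K) ≟ w
    ... | yes start≡w | _          = w-start⇒cycle q start≡w
    ... | no  _       | yes end≡w  = w-start⇒cycle (reverse (E-sym (B ∖ h)) q) end≡w
    ... | no start≢w  | no end≢w   = ends-off-w⇒cycle q start≢w end≢w

lemma3p3 : (k : ℕ) → 5 ≤ k → (𝒞 : CycleFamily) → KDense k 𝒞 →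
    (G : Graph) → Free G 𝒞 → (h : Fin (n G)) →
    (B : Subgraph G) → IsBlock G B →
    (r : Fin (n G)) → (RootedAt G h B r ⊎ (NearlyDominated G h B × r ≡ h)) →
    (m : ℕ) → PathInAvoiding G B r m → m ≤ k ∸ 3
lemma3p3 (suc (suc (suc K))) (s≤s (s≤s (s≤s 2≤K))) 𝒞 ((Cₖ , _) , _) G free h B block r kind m p
  with m ≤? K
... | yes m≤K = m≤K
... | no  m≰K = ⊥-elim (free (3 + K) Cₖ (cycle kind))
  where
  open GraphPaths G

  q : Path (E (B ∖ r)) (suc K)
  q = take (≰⇒> m≰K) (fromPathInAvoiding {B} p)

  cycle : RootedAt G h B r ⊎ (NearlyDominated G h B × r ≡ h) → HasCycle G (3 + K)
  cycle (inj₁ rooted) = rooted⇒cycle {B = B} rooted q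
  cycle (inj₂ ((h∈B , w , dominated) , refl)) =
    NearlyDominatedBlock.path⇒cycle B h w h∈B dominated connected-avoiding (≤-trans (s≤s z≤n) 2≤K) q
    where
    connected-avoiding : ∀ x u v → V B u → V B v → u ≢ x → v ≢ x → WalkInAvoiding G B x u v
    connected-avoiding =
      proj₂ (proj₂ (IsBlock⇒Is2Connected {H = B} block (take (m≤n⇒m≤1+n 2≤K) (map proj₁ q))))
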